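{- Let $n\ge 2$ and let $i,j$ be integers with $n+1\le i<j\le 3n$. For $k\ge 0$ let $R_k$ denote the $k\times k$ tridiagonal matrix with all diagonal entries $-2$ and all sub- and super-diagonal entries $1$. Let $W_2$ be the $(2n-2)\times(2n-2)$ symmetric block matrix \[W_2=\begin{pmatrix} R_{i-n-1} & 0 & E\\ 0 & R_{j-i-1} & 0\\ E^T & 0 & R_{3n-j}\end{pmatrix},\] where $E$ is the $(i-n-1)\times(3n-j)$ matrix whose only nonzero entry is a $1$ in position $(i-n-1,\,3n-j)$ (i.e. $E=e_{i-n-1}e_{3n-j}^T$, with $e_m$ the last standard basis vector of the appropriate size; blocks of size zero are empty). Then $\det(W_2)=2ij+2n(j-i)-(i^2+j^2)$. -}

module Defs where

open import Data.Nat as ℕ using (ℕ; zero; suc; _≡ᵇ_)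
open import Data.Integer using (ℤ; +_; -_; _+_; _*_)
open import Data.Fin using (Fin; toℕ; punchIn; splitAt)
open import Data.Sum using (inj₁; inj₂)
open import Data.Bool using (if_then_else_; _∧_; _∨_)

Mat : ℕ → Set
Mat k = Fin k → Fin k → ℤ

sgn : ℕ → ℤ
sgn zero = + 1
sgn (suc m) = - sgn m

sumℤ : ∀ {k} → (Fin k → ℤ) → ℤ
sumℤ {zero} f = + 0
sumℤ {suc k} f = f Fin.zero + sumℤ (λ x → f (Fin.suc x))

det : ∀ {k} → Mat k → ℤ
det {zero} M = + 1
det {suc k} M =
  sumℤ (λ c → sgn (toℕ c) * (M Fin.zero c * det (λ r s → M (Fin.suc r) (punchIn c s))))

R : (k : ℕ) → Mat k
R k p q =
  if toℕ p ≡ᵇ toℕ q then - (+ 2)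
  else if (suc (toℕ p) ≡ᵇ toℕ q) ∨ (toℕ p ≡ᵇ suc (toℕ q)) then + 1
  else + 0

E : (a c : ℕ) → Fin a → Fin c → ℤ
E a c p q = if (suc (toℕ p) ≡ᵇ a) ∧ (suc (toℕ q) ≡ᵇ c) then + 1 else + 0

-- the symmetric block matrix
--   [ R_a  0    E   ]
--   [ 0    R_b  0   ]
--   [ E^T  0    R_c ]
-- of size a + (b + c)
W : (a b c : ℕ) → Mat (a ℕ.+ (b ℕ.+ c))
W a b c p q with splitAt a p | splitAt a q
... | inj₁ p₁ | inj₁ q₁ = R a p₁ q₁
... | inj₁ p₁ | inj₂ q' with splitAt b q'
...   | inj₁ _  = + 0
...   | inj₂ q₃ = E a c p₁ q₃
W a b c p q | inj₂ p' | inj₁ q₁ with splitAt b p'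
...   | inj₁ _  = + 0
...   | inj₂ p₃ = E a c q₁ p₃
W a b c p q | inj₂ p' | inj₂ q' with splitAt b p' | splitAt b q'
...   | inj₁ p₂ | inj₁ q₂ = R b p₂ q₂
...   | inj₁ _  | inj₂ _  = + 0
...   | inj₂ _  | inj₁ _  = + 0
...   | inj₂ p₃ | inj₂ q₃ = R c p₃ q₃

W₂ : (n i j : ℕ) → Mat ((i ℕ.∸ n ℕ.∸ 1) ℕ.+ ((j ℕ.∸ i ℕ.∸ 1) ℕ.+ (3 ℕ.* n ℕ.∸ j)))
W₂ n i j = W (i ℕ.∸ n ℕ.∸ 1) (j ℕ.∸ i ℕ.∸ 1) (3 ℕ.* n ℕ.∸ j)

-- W a b c is, after reordering rows and columns, block diagonal: a copy of R b and the
-- matrix of the path on a + c vertices obtained by gluing the a-path to the c-path via E.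
-- Since det R k = (-1)^k (k+1) by the continuant recurrence d(k+2) = -2 d(k+1) - d k,
-- det W = (-1)^(a+b+c) (a+c+1)(b+1). For W₂ the exponent a + b + c = 2n - 2 is even,
-- b + 1 = j - i and a + c + 1 = 2n - (j - i), which gives the stated polynomial.
-- No reordering is needed: det expands along the first row, and peeling off the first
-- vertex always removes a vertex with at most one neighbour.
module Submission where

open import Defs
open import Data.Nat as ℕ using (ℕ; zero; suc; _≤_; _<_; _∸_; _≡ᵇ_)
open import Data.Nat.Properties as ℕP using ()
import Data.Nat.Tactic.RingSolver as ℕ-Solver
open import Data.Integer using (ℤ; +_; -_; _+_; _-_; _*_)
open import Data.Integer.Properties as ℤP using ()
open import Data.Integer.Tactic.RingSolver using (solve-∀)
open import Data.Fin using (Fin; zero; suc; toℕ; fromℕ; punchIn; splitAt)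
open import Data.Fin.Properties using (toℕ-fromℕ; toℕ-injective; suc-injective)
open import Data.Maybe using (Maybe; nothing; just)
open import Data.Bool using (if_then_else_; _∨_)
open import Data.Sum using (inj₁; inj₂)
open import Data.Empty using (⊥-elim)
open import Function using (_∘_)
open import Relation.Binary.PropositionalEquality
open ≡-Reasoning

sumℤ-cong : ∀ {k} {f g : Fin k → ℤ} → (∀ c → f c ≡ g c) → sumℤ f ≡ sumℤ g
sumℤ-cong {zero}  _   = refl
sumℤ-cong {suc k} f≗g = cong₂ _+_ (f≗g zero) (sumℤ-cong (f≗g ∘ suc))

sumℤ-zero : ∀ {k} {f : Fin k → ℤ} → (∀ c → f c ≡ + 0) → sumℤ f ≡ + 0
sumℤ-zero {zero}  _   = refl
sumℤ-zero {suc k} f≗0 = cong₂ _+_ (f≗0 zero) (sumℤ-zero (f≗0 ∘ suc))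

sumℤ-*ˡ : ∀ {k} x (f : Fin k → ℤ) → sumℤ (λ c → x * f c) ≡ x * sumℤ f
sumℤ-*ˡ {zero}  x f = sym (ℤP.*-zeroʳ x)
sumℤ-*ˡ {suc k} x f = trans (cong (_+_ (x * f zero)) (sumℤ-*ˡ x (f ∘ suc)))
                            (sym (ℤP.*-distribˡ-+ x (f zero) _))

sumℤ-single : ∀ {k} (f : Fin k → ℤ) p → (∀ c → c ≢ p → f c ≡ + 0) → sumℤ f ≡ f p
sumℤ-single f zero    f≗0 =
  trans (cong (_+_ (f zero)) (sumℤ-zero λ c → f≗0 (suc c) λ ())) (ℤP.+-identityʳ _)
sumℤ-single f (suc p) f≗0 =
  trans (cong₂ _+_ (f≗0 zero λ ())
                   (sumℤ-single (f ∘ suc) p λ c c≢p → f≗0 (suc c) (c≢p ∘ suc-injective)))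
        (ℤP.+-identityˡ _)

sgn-+ : ∀ m n → sgn (m ℕ.+ n) ≡ sgn m * sgn n
sgn-+ zero    n = sym (ℤP.*-identityˡ (sgn n))
sgn-+ (suc m) n = trans (cong -_ (sgn-+ m n)) (ℤP.neg-distribˡ-* (sgn m) (sgn n))

sgn-square : ∀ n → sgn n * sgn n ≡ + 1
sgn-square zero    = refl
sgn-square (suc n) = trans (neg-square (sgn n)) (sgn-square n)
  where
  neg-square : ∀ x → - x * - x ≡ x * x
  neg-square = solve-∀

minor : ∀ {k} → Mat (suc k) → Fin (suc k) → Mat k
minor M c r s = M (suc r) (punchIn c s)

cofactorTerm : ∀ {k} → Mat (suc k) → Fin (suc k) → ℤ
cofactorTerm M c = sgn (toℕ c) * (M zero c * det (minor M c))

cofactorTerm-zeroEntry : ∀ {k} (M : Mat (suc k)) c → M zero c ≡ + 0 → cofactorTerm M c ≡ + 0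
cofactorTerm-zeroEntry M c entry≡0 =
  trans (cong (λ x → sgn (toℕ c) * (x * det (minor M c))) entry≡0) (ℤP.*-zeroʳ (sgn (toℕ c)))

cofactorTerm-zeroMinor : ∀ {k} (M : Mat (suc k)) c → det (minor M c) ≡ + 0 → cofactorTerm M c ≡ + 0
cofactorTerm-zeroMinor M c minor≡0 = begin
  sgn (toℕ c) * (M zero c * det (minor M c)) ≡⟨ cong (λ d → sgn (toℕ c) * (M zero c * d)) minor≡0 ⟩
  sgn (toℕ c) * (M zero c * + 0)             ≡⟨ cong (_*_ (sgn (toℕ c))) (ℤP.*-zeroʳ (M zero c)) ⟩
  sgn (toℕ c) * + 0                          ≡⟨ ℤP.*-zeroʳ (sgn (toℕ c)) ⟩
  + 0                                        ∎

det-cong : ∀ {k} {M N : Mat k} → (∀ r s → M r s ≡ N r s) → det M ≡ det N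
det-cong {zero}  _   = refl
det-cong {suc k} M≗N = sumℤ-cong λ c →
  cong₂ (λ x d → sgn (toℕ c) * (x * d)) (M≗N zero c) (det-cong λ r s → M≗N (suc r) (punchIn c s))

det-zeroColumn : ∀ {k} (M : Mat (suc k)) → (∀ r → M r zero ≡ + 0) → det M ≡ + 0
det-zeroColumn {zero}  M col≡0 = cong (_+ + 0) (cofactorTerm-zeroEntry M zero (col≡0 zero))
det-zeroColumn {suc k} M col≡0 = sumℤ-zero term≡0
  where
  term≡0 : ∀ c → cofactorTerm M c ≡ + 0
  term≡0 zero    = cofactorTerm-zeroEntry M zero (col≡0 zero)
  term≡0 (suc c) = cofactorTerm-zeroMinor M (suc c) (det-zeroColumn (minor M (suc c)) (col≡0 ∘ suc))

det-singleEntryColumn : ∀ {k} (M : Mat (suc k)) (p : Fin (suc k)) →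
  (∀ r → r ≢ p → M r zero ≡ + 0) →
  det M ≡ sgn (toℕ p) * (M p zero * det (λ r s → M (punchIn p r) (suc s)))
det-singleEntryColumn {zero}  M zero    _     = ℤP.+-identityʳ _
det-singleEntryColumn {suc k} M zero    col≡0 =
  trans (cong (_+_ (cofactorTerm M zero)) (sumℤ-zero λ c →
           cofactorTerm-zeroMinor M (suc c) (det-zeroColumn (minor M (suc c)) λ r → col≡0 (suc r) λ ())))
        (ℤP.+-identityʳ _)
det-singleEntryColumn {suc k} M (suc p) col≡0 = begin
  cofactorTerm M zero + sumℤ (cofactorTerm M ∘ suc)
    ≡⟨ cong₂ _+_ (cofactorTerm-zeroEntry M zero (col≡0 zero λ ())) (sumℤ-cong shifted) ⟩
  + 0 + sumℤ (λ c → (- sgn (toℕ p) * y) * cofactorTerm Y c)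
    ≡⟨ ℤP.+-identityˡ _ ⟩
  sumℤ (λ c → (- sgn (toℕ p) * y) * cofactorTerm Y c)
    ≡⟨ sumℤ-*ˡ (- sgn (toℕ p) * y) (cofactorTerm Y) ⟩
  (- sgn (toℕ p) * y) * det Y
    ≡⟨ ℤP.*-assoc (- sgn (toℕ p)) y (det Y) ⟩
  - sgn (toℕ p) * (y * det Y) ∎
  where
  y : ℤ
  y = M (suc p) zero
  Y : Mat (suc k)
  Y r s = M (punchIn (suc p) r) (suc s)
  regroup : ∀ s m s′ y d → - s * (m * (s′ * (y * d))) ≡ (- s′ * y) * (s * (m * d))
  regroup = solve-∀
  shifted : ∀ c → cofactorTerm M (suc c) ≡ (- sgn (toℕ p) * y) * cofactorTerm Y c
  shifted c = trans
    (cong (λ d → - sgn (toℕ c) * (M zero (suc c) * d))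
          (det-singleEntryColumn (minor M (suc c)) p λ r r≢p → col≡0 (suc r) (r≢p ∘ suc-injective)))
    (regroup (sgn (toℕ c)) (M zero (suc c)) (sgn (toℕ p)) y (det (minor Y c)))

det-singleNeighbour : ∀ {k} (M : Mat (suc (suc k))) (p : Fin (suc k)) →
  (∀ q → q ≢ p → M zero (suc q) ≡ + 0) → (∀ r → r ≢ p → M (suc r) zero ≡ + 0) →
  det M ≡ M zero zero * det (λ r s → M (suc r) (suc s))
          - M zero (suc p) * M (suc p) zero * det (λ r s → M (suc (punchIn p r)) (suc (punchIn p s)))
det-singleNeighbour M p row≡0 col≡0 = begin
  cofactorTerm M zero + sumℤ (cofactorTerm M ∘ suc)
    ≡⟨ cong (_+_ (cofactorTerm M zero))
            (sumℤ-single (cofactorTerm M ∘ suc) p λ c c≢p →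
               cofactorTerm-zeroEntry M (suc c) (row≡0 c c≢p)) ⟩
  + 1 * (m * D) + - sgn (toℕ p) * (x * det (minor M (suc p)))
    ≡⟨ cong (λ d → + 1 * (m * D) + - sgn (toℕ p) * (x * d))
            (det-singleEntryColumn (minor M (suc p)) p col≡0) ⟩
  + 1 * (m * D) + - sgn (toℕ p) * (x * (sgn (toℕ p) * (y * Z)))
    ≡⟨ regroup (sgn (toℕ p)) m D x y Z ⟩
  m * D - (sgn (toℕ p) * sgn (toℕ p)) * (x * y * Z)
    ≡⟨ cong (λ t → m * D - t * (x * y * Z)) (sgn-square (toℕ p)) ⟩
  m * D - + 1 * (x * y * Z)
    ≡⟨ cong (_-_ (m * D)) (ℤP.*-identityˡ (x * y * Z)) ⟩
  m * D - x * y * Z ∎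
  where
  m x y D Z : ℤ
  m = M zero zero
  x = M zero (suc p)
  y = M (suc p) zero
  D = det (λ r s → M (suc r) (suc s))
  Z = det (λ r s → M (suc (punchIn p r)) (suc (punchIn p s)))
  regroup : ∀ s m D x y Z → + 1 * (m * D) + - s * (x * (s * (y * Z))) ≡ m * D - (s * s) * (x * y * Z)
  regroup = solve-∀

-- Matrices are described by ℕ-indexed kernels so that their size can change freely:
-- deleting the last row and column of principal (suc k) f leaves principal k f.
Kernel : Set
Kernel = ℕ → ℕ → ℤ

principal : (k : ℕ) → Kernel → Mat k
principal k f r s = f (toℕ r) (toℕ s)

link : Maybe ℕ → ℕ → ℤ
link nothing  x = + 0
link (just t) x = if x ≡ᵇ t then + 1 else + 0

link-self : ∀ t → link (just t) t ≡ + 1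
link-self zero    = refl
link-self (suc t) = link-self t

link-≢ : ∀ {x t} → x ≢ t → link (just t) x ≡ + 0
link-≢ {zero}  {zero}  0≢0 = ⊥-elim (0≢0 refl)
link-≢ {zero}  {suc t} _   = refl
link-≢ {suc x} {zero}  _   = refl
link-≢ {suc x} {suc t} x≢t = link-≢ (x≢t ∘ cong suc)

adjoin : Maybe ℕ → Kernel → Kernel
adjoin t f zero    zero    = - + 2
adjoin t f zero    (suc y) = link t y
adjoin t f (suc x) zero    = link t x
adjoin t f (suc x) (suc y) = f x y

det-adjoin-isolated : ∀ {k} (f : Kernel) →
  det (principal (suc k) (adjoin nothing f)) ≡ - + 2 * det (principal k f)
det-adjoin-isolated {k} f =
  trans (det-singleEntryColumn (principal (suc k) (adjoin nothing f)) zero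
           λ { zero 0≢0 → ⊥-elim (0≢0 refl) ; (suc r) _ → refl })
        (ℤP.*-identityˡ _)

det-adjoin : ∀ {k} (f : Kernel) (p : Fin (suc k)) →
  det (principal (suc (suc k)) (adjoin (just (toℕ p)) f))
    ≡ - + 2 * det (principal (suc k) f) - det (λ r s → f (toℕ (punchIn p r)) (toℕ (punchIn p s)))
det-adjoin {k} f p =
  trans (det-singleNeighbour (principal (suc (suc k)) (adjoin (just (toℕ p)) f)) p
           (λ q q≢p → link-≢ (q≢p ∘ toℕ-injective)) (λ r r≢p → link-≢ (r≢p ∘ toℕ-injective)))
        (cong (_-_ (- + 2 * det (principal (suc k) f)))
              (trans (cong₂ (λ x y → x * y * Z) (link-self (toℕ p)) (link-self (toℕ p)))
                     (ℤP.*-identityˡ Z)))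
  where
  Z : ℤ
  Z = det (λ r s → f (toℕ (punchIn p r)) (toℕ (punchIn p s)))

det-adjoin-first : ∀ {k} (f : Kernel) →
  det (principal (suc (suc k)) (adjoin (just 0) f))
    ≡ - + 2 * det (principal (suc k) f) - det (principal k (λ x y → f (suc x) (suc y)))
det-adjoin-first {k} f = det-adjoin {k} f zero

toℕ-punchIn-fromℕ : ∀ {k} (r : Fin k) → toℕ (punchIn (fromℕ k) r) ≡ toℕ r
toℕ-punchIn-fromℕ zero    = refl
toℕ-punchIn-fromℕ (suc r) = cong suc (toℕ-punchIn-fromℕ r)

det-adjoin-last : ∀ {k} (f : Kernel) →
  det (principal (suc (suc k)) (adjoin (just k) f)) ≡ - + 2 * det (principal (suc k) f) - det (principal k f)
det-adjoin-last {k} f = begin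
  det (principal (suc (suc k)) (adjoin (just k) f))
    ≡⟨ cong (λ t → det (principal (suc (suc k)) (adjoin (just t) f))) (sym (toℕ-fromℕ k)) ⟩
  det (principal (suc (suc k)) (adjoin (just (toℕ (fromℕ k))) f))
    ≡⟨ det-adjoin {k} f (fromℕ k) ⟩
  - + 2 * det (principal (suc k) f) - det (λ r s → f (toℕ (punchIn (fromℕ k) r)) (toℕ (punchIn (fromℕ k) s)))
    ≡⟨ cong (_-_ (- + 2 * det (principal (suc k) f)))
            (det-cong {k} λ r s → cong₂ f (toℕ-punchIn-fromℕ r) (toℕ-punchIn-fromℕ s)) ⟩
  - + 2 * det (principal (suc k) f) - det (principal k f) ∎

tridiag : Kernel
tridiag x y =
  if x ≡ᵇ y then - (+ 2)
  else if (suc x ≡ᵇ y) ∨ (x ≡ᵇ suc y) then + 1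
  else + 0

tridiag-adjoin : ∀ x y → tridiag x y ≡ adjoin (just 0) tridiag x y
tridiag-adjoin zero          zero          = refl
tridiag-adjoin zero          (suc zero)    = refl
tridiag-adjoin zero          (suc (suc y)) = refl
tridiag-adjoin (suc zero)    zero          = refl
tridiag-adjoin (suc (suc x)) zero          = refl
tridiag-adjoin (suc x)       (suc y)       = refl

tridiagDet : ℕ → ℤ
tridiagDet k = sgn k * + suc k

tridiagDet-recurrence : ∀ k → tridiagDet (suc (suc k)) ≡ - + 2 * tridiagDet (suc k) - tridiagDet k
tridiagDet-recurrence k
  rewrite ℤP.pos-+ 1 k | ℤP.pos-+ 2 k | ℤP.pos-+ 3 k = identity (sgn k) (+ k)
  where
  identity : ∀ s n → - - s * (+ 3 + n) ≡ - + 2 * (- s * (+ 2 + n)) - s * (+ 1 + n)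
  identity = solve-∀

tridiagDet-recurrence-*ʳ : ∀ k t →
  - + 2 * (tridiagDet (suc k) * t) - tridiagDet k * t ≡ tridiagDet (suc (suc k)) * t
tridiagDet-recurrence-*ʳ k t = begin
  - + 2 * (tridiagDet (suc k) * t) - tridiagDet k * t ≡⟨ distrib (tridiagDet (suc k)) (tridiagDet k) t ⟩
  (- + 2 * tridiagDet (suc k) - tridiagDet k) * t     ≡⟨ cong (_* t) (sym (tridiagDet-recurrence k)) ⟩
  tridiagDet (suc (suc k)) * t                        ∎
  where
  distrib : ∀ x y t → - + 2 * (x * t) - y * t ≡ (- + 2 * x - y) * t
  distrib = solve-∀

det-tridiag : ∀ k → det (principal k tridiag) ≡ tridiagDet k
det-tridiag zero          = refl
det-tridiag (suc zero)    = refl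
det-tridiag (suc (suc k)) = begin
  det (principal (suc (suc k)) tridiag)
    ≡⟨ det-cong {suc (suc k)} (λ r s → tridiag-adjoin (toℕ r) (toℕ s)) ⟩
  det (principal (suc (suc k)) (adjoin (just 0) tridiag))
    ≡⟨ det-adjoin-first {k} tridiag ⟩
  - + 2 * det (principal (suc k) tridiag) - det (principal k tridiag)
    ≡⟨ cong₂ (λ x y → - + 2 * x - y) (det-tridiag (suc k)) (det-tridiag k) ⟩
  - + 2 * tridiagDet (suc k) - tridiagDet k
    ≡⟨ sym (tridiagDet-recurrence k) ⟩
  tridiagDet (suc (suc k)) ∎

pathNeighbour : ℕ → Maybe ℕ
pathNeighbour zero    = nothing
pathNeighbour (suc _) = just 0

prependPath : ℕ → Kernel → Kernel
prependPath zero    f = f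
prependPath (suc b) f = adjoin (pathNeighbour b) (prependPath b f)

det-prependPath : ∀ b {m} (f : Kernel) →
  det (principal (b ℕ.+ m) (prependPath b f)) ≡ tridiagDet b * det (principal m f)
det-prependPath zero              f = sym (ℤP.*-identityˡ _)
det-prependPath (suc zero)    {m} f = det-adjoin-isolated {m} f
det-prependPath (suc (suc b)) {m} f = begin
  det (principal (suc (suc b) ℕ.+ m) (prependPath (suc (suc b)) f))
    ≡⟨ det-adjoin-first {b ℕ.+ m} (prependPath (suc b) f) ⟩
  - + 2 * det (principal (suc b ℕ.+ m) (prependPath (suc b) f)) - det (principal (b ℕ.+ m) (prependPath b f))
    ≡⟨ cong₂ (λ x y → - + 2 * x - y) (det-prependPath (suc b) f) (det-prependPath b f) ⟩
  - + 2 * (tridiagDet (suc b) * det (principal m f)) - tridiagDet b * det (principal m f)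
    ≡⟨ tridiagDet-recurrence-*ʳ b (det (principal m f)) ⟩
  tridiagDet (suc (suc b)) * det (principal m f) ∎

-- The last vertex of the a-block is joined (through E) to the last vertex of the c-block.
blockNeighbour : ℕ → ℕ → ℕ → Maybe ℕ
blockNeighbour zero    b zero    = nothing
blockNeighbour zero    b (suc c) = just (b ℕ.+ c)
blockNeighbour (suc a) b c       = just 0

blockKernel : ℕ → ℕ → ℕ → Kernel
blockKernel zero    b c = prependPath b tridiag
blockKernel (suc a) b c = adjoin (blockNeighbour a b c) (blockKernel a b c)

det-blockKernel : ∀ a b c →
  det (principal (a ℕ.+ (b ℕ.+ c)) (blockKernel a b c)) ≡ tridiagDet (a ℕ.+ c) * tridiagDet b
det-blockKernel zero b c = begin
  det (principal (b ℕ.+ c) (prependPath b tridiag)) ≡⟨ det-prependPath b tridiag ⟩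
  tridiagDet b * det (principal c tridiag)          ≡⟨ cong (tridiagDet b *_) (det-tridiag c) ⟩
  tridiagDet b * tridiagDet c                       ≡⟨ ℤP.*-comm (tridiagDet b) (tridiagDet c) ⟩
  tridiagDet c * tridiagDet b                       ∎
det-blockKernel (suc zero) b zero = begin
  det (principal (suc (b ℕ.+ 0)) (adjoin nothing (prependPath b tridiag)))
    ≡⟨ det-adjoin-isolated {b ℕ.+ 0} (prependPath b tridiag) ⟩
  - + 2 * det (principal (b ℕ.+ 0) (prependPath b tridiag))
    ≡⟨ cong (- + 2 *_) (det-blockKernel zero b zero) ⟩
  - + 2 * (+ 1 * tridiagDet b)
    ≡⟨ cong (- + 2 *_) (ℤP.*-identityˡ (tridiagDet b)) ⟩
  tridiagDet 1 * tridiagDet b ∎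
det-blockKernel (suc zero) b (suc c) = begin
  det (principal (suc (b ℕ.+ suc c)) K)
    ≡⟨ cong (λ n → det (principal (suc n) K)) (ℕP.+-suc b c) ⟩
  det (principal (suc (suc (b ℕ.+ c))) K)
    ≡⟨ det-adjoin-last {b ℕ.+ c} (prependPath b tridiag) ⟩
  - + 2 * P (suc (b ℕ.+ c)) - P (b ℕ.+ c)
    ≡⟨ cong (λ n → - + 2 * P n - P (b ℕ.+ c)) (sym (ℕP.+-suc b c)) ⟩
  - + 2 * P (b ℕ.+ suc c) - P (b ℕ.+ c)
    ≡⟨ cong₂ (λ x y → - + 2 * x - y) (det-blockKernel zero b (suc c)) (det-blockKernel zero b c) ⟩
  - + 2 * (tridiagDet (suc c) * tridiagDet b) - tridiagDet c * tridiagDet b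
    ≡⟨ tridiagDet-recurrence-*ʳ c (tridiagDet b) ⟩
  tridiagDet (suc (suc c)) * tridiagDet b ∎
  where
  K : Kernel
  K = blockKernel 1 b (suc c)
  P : ℕ → ℤ
  P n = det (principal n (prependPath b tridiag))
det-blockKernel (suc (suc a)) b c = begin
  det (principal (suc (suc (a ℕ.+ (b ℕ.+ c)))) (adjoin (just 0) (blockKernel (suc a) b c)))
    ≡⟨ det-adjoin-first {a ℕ.+ (b ℕ.+ c)} (blockKernel (suc a) b c) ⟩
  - + 2 * det (principal (suc a ℕ.+ (b ℕ.+ c)) (blockKernel (suc a) b c))
    - det (principal (a ℕ.+ (b ℕ.+ c)) (blockKernel a b c))
    ≡⟨ cong₂ (λ x y → - + 2 * x - y) (det-blockKernel (suc a) b c) (det-blockKernel a b c) ⟩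
  - + 2 * (tridiagDet (suc a ℕ.+ c) * tridiagDet b) - tridiagDet (a ℕ.+ c) * tridiagDet b
    ≡⟨ tridiagDet-recurrence-*ʳ (a ℕ.+ c) (tridiagDet b) ⟩
  tridiagDet (suc (suc a) ℕ.+ c) * tridiagDet b ∎

W-shift : ∀ a b c p q → W (suc a) b c (suc p) (suc q) ≡ W a b c p q
W-shift a b c p q with splitAt a p | splitAt a q
... | inj₁ _ | inj₁ _ = refl
... | inj₁ _ | inj₂ q′ with splitAt b q′
...   | inj₁ _ = refl
...   | inj₂ _ = refl
W-shift a b c p q | inj₂ p′ | inj₁ _ with splitAt b p′
...   | inj₁ _ = refl
...   | inj₂ _ = refl
W-shift a b c p q | inj₂ p′ | inj₂ q′ with splitAt b p′ | splitAt b q′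
...   | inj₁ _ | inj₁ _ = refl
...   | inj₁ _ | inj₂ _ = refl
...   | inj₂ _ | inj₁ _ = refl
...   | inj₂ _ | inj₂ _ = refl

W₀-shift : ∀ b c p q → W 0 (suc b) c (suc p) (suc q) ≡ W 0 b c p q
W₀-shift b c p q with splitAt b p | splitAt b q
... | inj₁ _ | inj₁ _ = refl
... | inj₁ _ | inj₂ _ = refl
... | inj₂ _ | inj₁ _ = refl
... | inj₂ _ | inj₂ _ = refl

W₀≡prependPath : ∀ b c p q → W 0 b c p q ≡ prependPath b tridiag (toℕ p) (toℕ q)
W₀≡prependPath zero          c p       q       = refl
W₀≡prependPath (suc b)       c (suc p) (suc q) = trans (W₀-shift b c p q) (W₀≡prependPath b c p q)
W₀≡prependPath (suc b)       c zero    zero    = refl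
W₀≡prependPath (suc zero)    c zero    (suc q) = refl
W₀≡prependPath (suc zero)    c (suc p) zero    = refl
W₀≡prependPath (suc (suc b)) c zero    (suc zero)    = refl
W₀≡prependPath (suc (suc b)) c (suc zero) zero       = refl
W₀≡prependPath (suc (suc b)) c zero    (suc (suc q)) with splitAt b q
... | inj₁ _ = refl
... | inj₂ _ = refl
W₀≡prependPath (suc (suc b)) c (suc (suc p)) zero    with splitAt b p
... | inj₁ _ = refl
... | inj₂ _ = refl

W₁-firstRow : ∀ b c q → W 1 b c zero (suc q) ≡ link (blockNeighbour 0 b c) (toℕ q)
W₁-firstRow zero    (suc c) q             = refl
W₁-firstRow (suc b) zero    zero          = refl
W₁-firstRow (suc b) (suc c) zero          = refl
W₁-firstRow (suc b) c       (suc q)       = trans shift (trans (W₁-firstRow b c q) (link-suc c))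
  where
  shift : W 1 (suc b) c zero (suc (suc q)) ≡ W 1 b c zero (suc q)
  shift with splitAt b q
  ... | inj₁ _ = refl
  ... | inj₂ _ = refl
  link-suc : ∀ c → link (blockNeighbour 0 b c) (toℕ q) ≡ link (blockNeighbour 0 (suc b) c) (suc (toℕ q))
  link-suc zero    = refl
  link-suc (suc c) = refl

W₁-firstColumn : ∀ b c p → W 1 b c (suc p) zero ≡ link (blockNeighbour 0 b c) (toℕ p)
W₁-firstColumn zero    (suc c) p             = refl
W₁-firstColumn (suc b) zero    zero          = refl
W₁-firstColumn (suc b) (suc c) zero          = refl
W₁-firstColumn (suc b) c       (suc p)       = trans shift (trans (W₁-firstColumn b c p) (link-suc c))
  where
  shift : W 1 (suc b) c (suc (suc p)) zero ≡ W 1 b c (suc p) zero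
  shift with splitAt b p
  ... | inj₁ _ = refl
  ... | inj₂ _ = refl
  link-suc : ∀ c → link (blockNeighbour 0 b c) (toℕ p) ≡ link (blockNeighbour 0 (suc b) c) (suc (toℕ p))
  link-suc zero    = refl
  link-suc (suc c) = refl

W≡blockKernel : ∀ a b c p q → W a b c p q ≡ blockKernel a b c (toℕ p) (toℕ q)
W≡blockKernel zero          b c p       q       = W₀≡prependPath b c p q
W≡blockKernel (suc a)       b c (suc p) (suc q) = trans (W-shift a b c p q) (W≡blockKernel a b c p q)
W≡blockKernel (suc a)       b c zero    zero    = refl
W≡blockKernel (suc zero)    b c zero    (suc q) = W₁-firstRow b c q
W≡blockKernel (suc zero)    b c (suc p) zero    = W₁-firstColumn b c p
W≡blockKernel (suc (suc a)) b c zero    (suc zero) = refl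
W≡blockKernel (suc (suc a)) b c (suc zero) zero    = refl
W≡blockKernel (suc (suc a)) b c zero    (suc (suc q)) with splitAt a q
... | inj₁ _ = refl
... | inj₂ q′ with splitAt b q′
...   | inj₁ _ = refl
...   | inj₂ _ = refl
W≡blockKernel (suc (suc a)) b c (suc (suc p)) zero    with splitAt a p
... | inj₁ _ = refl
... | inj₂ p′ with splitAt b p′
...   | inj₁ _ = refl
...   | inj₂ _ = refl

det-W : ∀ a b c → det (W a b c) ≡ tridiagDet (a ℕ.+ c) * tridiagDet b
det-W a b c = trans (det-cong (W≡blockKernel a b c)) (det-blockKernel a b c)

suc[m+[n∸m∸1]]≡n : ∀ {m n} → m < n → suc (m ℕ.+ (n ∸ m ∸ 1)) ≡ n
suc[m+[n∸m∸1]]≡n {zero}  {suc n} _         = refl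
suc[m+[n∸m∸1]]≡n {suc m} {suc n} (ℕ.s≤s m<n) = cong suc (suc[m+[n∸m∸1]]≡n m<n)

blockSizes : ∀ {n a b c i j} → suc (n ℕ.+ a) ≡ i → suc (i ℕ.+ b) ≡ j → j ℕ.+ c ≡ 3 ℕ.* n →
  suc (a ℕ.+ c) ℕ.+ suc b ≡ n ℕ.+ n
blockSizes {n} {a} {b} {c} refl refl total = ℕP.+-cancelˡ-≡ n _ _ (begin
  n ℕ.+ (suc (a ℕ.+ c) ℕ.+ suc b) ≡⟨ regroup n a b c ⟩
  suc (suc (n ℕ.+ a) ℕ.+ b) ℕ.+ c ≡⟨ total ⟩
  3 ℕ.* n                         ≡⟨ triple n ⟩
  n ℕ.+ (n ℕ.+ n)                 ∎)
  where
  regroup : ∀ n a b c → n ℕ.+ (suc (a ℕ.+ c) ℕ.+ suc b) ≡ suc (suc (n ℕ.+ a) ℕ.+ b) ℕ.+ c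
  regroup = ℕ-Solver.solve-∀
  triple : ∀ n → 3 ℕ.* n ≡ n ℕ.+ (n ℕ.+ n)
  triple = ℕ-Solver.solve-∀

sgn-suc-+-suc : ∀ x y → sgn (suc x ℕ.+ suc y) ≡ sgn (x ℕ.+ y)
sgn-suc-+-suc x y = trans (cong (λ m → - sgn m) (ℕP.+-suc x y)) (ℤP.neg-involutive (sgn (x ℕ.+ y)))

tridiagDet-*-evenSum : ∀ {x y n} → suc x ℕ.+ suc y ≡ n ℕ.+ n →
  tridiagDet x * tridiagDet y ≡ + suc x * + suc y
tridiagDet-*-evenSum {x} {y} {n} even = begin
  sgn x * + suc x * (sgn y * + suc y)  ≡⟨ regroup (sgn x) (sgn y) (+ suc x) (+ suc y) ⟩
  sgn x * sgn y * (+ suc x * + suc y)  ≡⟨ cong (_* (+ suc x * + suc y)) sign≡1 ⟩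
  + 1 * (+ suc x * + suc y)            ≡⟨ ℤP.*-identityˡ _ ⟩
  + suc x * + suc y                    ∎
  where
  regroup : ∀ s t u v → s * u * (t * v) ≡ s * t * (u * v)
  regroup = solve-∀
  sign≡1 : sgn x * sgn y ≡ + 1
  sign≡1 = begin
    sgn x * sgn y          ≡⟨ sym (sgn-+ x y) ⟩
    sgn (x ℕ.+ y)          ≡⟨ sym (sgn-suc-+-suc x y) ⟩
    sgn (suc x ℕ.+ suc y)  ≡⟨ cong sgn even ⟩
    sgn (n ℕ.+ n)          ≡⟨ sgn-+ n n ⟩
    sgn n * sgn n          ≡⟨ sgn-square n ⟩
    + 1                    ∎

pos-difference : ∀ {m k l} → m ℕ.+ k ≡ l → + k ≡ + l - + m
pos-difference {m} {k} refl = begin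
  + k                  ≡⟨ cancel (+ m) (+ k) ⟩
  + m + + k - + m      ≡⟨ cong (_- + m) (sym (ℤP.pos-+ m k)) ⟩
  + (m ℕ.+ k) - + m    ∎
  where
  cancel : ∀ x y → y ≡ x + y - x
  cancel = solve-∀

lemma9 : (n i j : ℕ) → 2 ≤ n → n ℕ.+ 1 ≤ i → i < j → j ≤ 3 ℕ.* n →
         det (W₂ n i j)
           ≡ (+ 2 * + i * + j + + 2 * + n * (+ j - + i)) - (+ i * + i + + j * + j)
lemma9 n i j _ n+1≤i i<j j≤3n = begin
  det (W a b c)                                 ≡⟨ det-W a b c ⟩
  tridiagDet (a ℕ.+ c) * tridiagDet b           ≡⟨ tridiagDet-*-evenSum {a ℕ.+ c} {b} {n} sizes ⟩
  + suc (a ℕ.+ c) * + suc b                     ≡⟨ cong (_* + suc b) outer ⟩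
  (+ (n ℕ.+ n) - + suc b) * + suc b             ≡⟨ cong (λ d → (+ (n ℕ.+ n) - d) * d) gap ⟩
  (+ (n ℕ.+ n) - (+ j - + i)) * (+ j - + i)     ≡⟨ cong (λ x → (x - (+ j - + i)) * (+ j - + i)) (ℤP.pos-+ n n) ⟩
  (+ n + + n - (+ j - + i)) * (+ j - + i)       ≡⟨ expand (+ n) (+ i) (+ j) ⟩
  (+ 2 * + i * + j + + 2 * + n * (+ j - + i)) - (+ i * + i + + j * + j) ∎
  where
  a b c : ℕ
  a = i ∸ n ∸ 1
  b = j ∸ i ∸ 1
  c = 3 ℕ.* n ∸ j
  i≡ : suc (n ℕ.+ a) ≡ i
  i≡ = suc[m+[n∸m∸1]]≡n (subst (_≤ i) (ℕP.+-comm n 1) n+1≤i)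
  j≡ : suc (i ℕ.+ b) ≡ j
  j≡ = suc[m+[n∸m∸1]]≡n i<j
  sizes : suc (a ℕ.+ c) ℕ.+ suc b ≡ n ℕ.+ n
  sizes = blockSizes i≡ j≡ (ℕP.m+[n∸m]≡n j≤3n)
  gap : + suc b ≡ + j - + i
  gap = pos-difference {i} (trans (ℕP.+-suc i b) j≡)
  outer : + suc (a ℕ.+ c) ≡ + (n ℕ.+ n) - + suc b
  outer = pos-difference {suc b} {suc (a ℕ.+ c)} (trans (ℕP.+-comm (suc b) _) sizes)
  expand : ∀ n i j →
    (n + n - (j - i)) * (j - i) ≡ (+ 2 * i * j + + 2 * n * (j - i)) - (i * i + j * j)
  expand = solve-∀
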